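{- Let $p$ be a prime power, $s\ge1$, $d\ge 2$, $R=\mathbb{F}_p[t]/\langle t^s\rangle$. For $i\in[d]$ let $K_i=\langle e_{j,j+1}(at+b) : a,b\in\mathbb{F}_p,\ j\in[d]\setminus\{i\}\rangle$ and $G=\langle K_1,\ldots,K_d\rangle$. Then in the coset complex $\mathcal{X}(G,\{K_1,\ldots,K_d\})$, the $1$-skeleton of the link of every face with at most $d-2$ vertices (including the empty face, whose link is the whole complex) is connected.
   Context: $R=\mathbb{F}_p[t]/\langle t^s\rangle$. $e_{i,j}(r)$ is the $d\times d$ matrix over $R$ with $1$'s on the diagonal, $r$ in entry $(i,j)$ and $0$ elsewhere; indices modulo $d$ (e.g. $e_{d,d+1}(r)=e_{d,1}(r)$). The coset complex $\mathcal{X}(G,\{K_1,\ldots,K_d\})$ has as vertices the left cosets $gK_i$ (type $i$) and as faces the sets of cosets of pairwise distinct types with nonempty common intersection. The link of a face $v$ is $X_v=\{T\setminus v: T\in X,\ v\subseteq T\}$; its $1$-skeleton is the graph formed by its vertices and $2$-element faces. -}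

module Defs where

open import Level using (0ℓ)
open import Algebra.Bundles using (CommutativeRing)
open import Data.Nat using (ℕ; zero; suc; _∸_; _<_)
import Data.Nat as ℕ
open import Data.Nat.Properties using (suc-injective)
open import Data.Fin using (Fin; zero; suc; toℕ; lower₁)
import Data.Fin as Fin
open import Data.List using (List; []; _∷_; foldr; map; upTo; allFin)
open import Data.List.Relation.Unary.Any using (Any)
open import Data.List.Relation.Unary.All using (All)
open import Data.List.Relation.Unary.AllPairs using (AllPairs)
open import Data.Product using (Σ; _×_; _,_)
open import Relation.Nullary using (¬_; Dec; yes; no)
open import Relation.Binary.PropositionalEquality using (_≡_; sym)

-- A finite field: a commutative ring (with setoid equality) in which 0 ≠ 1,
-- every nonzero element has an inverse, equality is decidable and the
-- carrier is finitely enumerated.  (The finite fields are exactly the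
-- fields F_q with q a prime power.)
record FiniteField : Set₁ where
  field
    ring : CommutativeRing 0ℓ 0ℓ
  open CommutativeRing ring
  field
    _≟_      : ∀ x y → Dec (x ≈ y)
    0≉1      : ¬ (0# ≈ 1#)
    inverse  : ∀ x → ¬ (x ≈ 0#) → Σ Carrier (λ y → (x * y) ≈ 1#)
    elements : List Carrier
    complete : ∀ x → Any (x ≈_) elements

next : ∀ {n} → Fin n → Fin n
next {suc n} j with toℕ j ℕ.≟ n
... | yes _ = zero
... | no ne = lower₁ (suc j) (λ eq → ne (sym (suc-injective eq)))

module Construction (𝔽 : FiniteField) (s d : ℕ) where
  open FiniteField 𝔽
  open CommutativeRing ring

  -- R = F[t]/⟨t^s⟩ : coefficient sequences (coefficient k of t^k),
  -- two sequences being equal in R iff their coefficients below s agree.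
  R : Set
  R = ℕ → Carrier

  _≈R_ : R → R → Set
  a ≈R b = ∀ k → k < s → a k ≈ b k

  0R : R
  0R _ = 0#

  1R : R
  1R zero = 1#
  1R (suc _) = 0#

  _+R_ : R → R → R
  (a +R b) k = a k + b k

  sumF : List Carrier → Carrier
  sumF = foldr _+_ 0#

  _*R_ : R → R → R
  (a *R b) k = sumF (map (λ i → a i * b (k ∸ i)) (upTo (suc k)))

  lin : Carrier → Carrier → R
  lin a b zero = b
  lin a b (suc zero) = a
  lin a b (suc (suc _)) = 0#

  Mat : Set
  Mat = Fin d → Fin d → R

  _≈M_ : Mat → Mat → Set
  A ≈M B = ∀ i j → A i j ≈R B i j

  sumR : List R → R
  sumR = foldr _+R_ 0R

  _·_ : Mat → Mat → Mat
  (A · B) i j = sumR (map (λ l → A i l *R B l j) (allFin d))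

  I : Mat
  I k l with k Fin.≟ l
  ... | yes _ = 1R
  ... | no _ = 0R

  e : Fin d → Fin d → R → Mat
  e i j r k l with k Fin.≟ l | k Fin.≟ i | l Fin.≟ j
  ... | yes _ | _     | _     = 1R
  ... | no _  | yes _ | yes _ = r
  ... | no _  | yes _ | no _  = 0R
  ... | no _  | no _  | _     = 0R

  data ⟨_⟩ (P : Mat → Set) : Mat → Set where
    g-id   : ⟨ P ⟩ I
    g-gen  : ∀ {g M} → P g → ⟨ P ⟩ M → ⟨ P ⟩ (g · M)
    g-inv  : ∀ {g h M} → P g → (h · g) ≈M I → ⟨ P ⟩ M → ⟨ P ⟩ (h · M)
    g-resp : ∀ {M N} → M ≈M N → ⟨ P ⟩ M → ⟨ P ⟩ N

  GenK : Fin d → Mat → Set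
  GenK i M = Σ (Fin d) λ j → ¬ (j ≡ i) × Σ Carrier λ a → Σ Carrier λ b →
               M ≈M e j (next j) (lin a b)

  K : Fin d → Mat → Set
  K i = ⟨ GenK i ⟩

  G : Mat → Set
  G = ⟨ (λ M → Σ (Fin d) λ i → K i M) ⟩

  -- a vertex of the coset complex: the coset (rep · K_type), rep ∈ G
  record Vertex : Set where
    field
      type   : Fin d
      rep    : Mat
      repInG : G rep
  open Vertex public

  InCoset : Mat → Vertex → Set
  InCoset x u = Σ Mat λ k → K (type u) k × (x ≈M (rep u · k))

  SameVertex : Vertex → Vertex → Set
  SameVertex u w = (type u ≡ type w) × InCoset (rep w) u

  IsFace : List Vertex → Set
  IsFace vs = AllPairs (λ u w → ¬ (type u ≡ type w)) vs ×
              Σ Mat (λ x → G x × All (InCoset x) vs)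

  -- paths in the 1-skeleton of the link of v (vertices: u with v ∪ {u} a face;
  -- edges: {u,w} with v ∪ {u,w} a face)
  data Reach (v : List Vertex) : Vertex → Vertex → Set where
    here : ∀ {u w} → SameVertex u w → Reach v u w
    step : ∀ {u w z} → IsFace (u ∷ w ∷ v) → Reach v w z → Reach v u z

  LinkConnected : List Vertex → Set
  LinkConnected v =
    Σ Vertex (λ u → IsFace (u ∷ v)) ×
    (∀ u w → IsFace (u ∷ v) → IsFace (w ∷ v) → Reach v u w)

module Submission where

-- Let v be such a face with type set T, and y a point of G lying in all
-- cosets of v.  Link vertices through a common such point are adjacent,
-- and right multiplication by an element g ∈ K_c (c ∉ T) that also lies in
-- every K_t, t ∈ T, moves along the link, because z K_c = z g K_c.  Hence
-- the link is connected once the stabiliser G ∩ ⋂_{t ∈ T} K_t is generated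
-- by such "admissible" elements.  For T = ∅ the stabiliser is
-- G = ⟨K_1, …, K_d⟩.  For T ≠ ∅ we prove ⋂_{t ∈ T} K_t = H T, where
-- H T = ⟨ e_{j,j+1}(at+b) : j ∉ T ⟩, by comparing zero patterns: elements
-- of H T vanish at every position (a, b) whose cyclic interval [a, b)
-- meets T.  Finally a generator of H T with index j lies in K_c for some
-- type c ∉ T ∪ {j}, which exists because |T| ≤ d - 2.

open import Defs
open import Data.Nat using (ℕ; _≤_; _∸_; suc; s≤s; z≤n)
open import Data.List using (List; length)

module CyclicOrder (n : ℕ) where
  open import Data.Nat as ℕ using (ℕ; zero; suc; _+_; _∸_; _≤_; _<_; s≤s; z≤n)
  open import Data.Nat.Properties
  open import Data.Nat.Induction using (<-rec)
  open import Data.Fin as Fin using (Fin; zero; suc; toℕ)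
  open import Data.Fin.Properties using (toℕ-injective; toℕ<n; toℕ-lower₁; pigeonhole; ¬∀⟶∃¬)
  open import Data.List using (List; length; lookup)
  open import Data.List.Relation.Unary.Any using (index)
  open import Data.List.Relation.Unary.Any.Properties using (lookup-index)
  open import Data.List.Membership.Propositional using (_∈_; _∉_)
  import Data.List.Membership.DecPropositional as DecMembership
  open import Data.Product using (Σ; _×_; _,_)
  open import Data.Sum using (_⊎_; inj₁; inj₂)
  open import Data.Empty using (⊥-elim)
  open import Relation.Nullary using (¬_; yes; no)
  open import Relation.Binary.PropositionalEquality

  next-last : (j : Fin (suc n)) → toℕ j ≡ n → next j ≡ zero
  next-last j eq with toℕ j ℕ.≟ n
  ... | yes _ = refl
  ... | no ne = ⊥-elim (ne eq)

  next-toℕ : (j : Fin (suc n)) → toℕ j ≢ n → toℕ (next j) ≡ suc (toℕ j)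
  next-toℕ j ne with toℕ j ℕ.≟ n
  ... | yes e  = ⊥-elim (ne e)
  ... | no ne′ = toℕ-lower₁ (suc j) (λ eq → ne′ (sym (suc-injective eq)))

  next-≢ : 1 ≤ n → (j : Fin (suc n)) → next j ≢ j
  next-≢ 1≤n j eq with toℕ j ℕ.≟ n | next-toℕ j
  ... | yes e | _  = <⇒≢ 1≤n (trans (cong toℕ eq) e)
  ... | no ne | nt = 1+n≢n (trans (sym (nt ne)) (cong toℕ eq))

  walk : ℕ → Fin (suc n) → Fin (suc n)
  walk zero    x = x
  walk (suc m) x = walk m (next x)

  walk-+ : ∀ l m x → walk (l + m) x ≡ walk m (walk l x)
  walk-+ zero    m x = refl
  walk-+ (suc l) m x = walk-+ l m (next x)

  walk-toℕ : ∀ m (x : Fin (suc n)) → toℕ x + m ≤ n → toℕ (walk m x) ≡ toℕ x + m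
  walk-toℕ zero    x _  = sym (+-identityʳ _)
  walk-toℕ (suc m) x le = begin
    toℕ (walk m (next x)) ≡⟨ walk-toℕ m (next x) (subst (_≤ n) shift le) ⟩
    toℕ (next x) + m      ≡⟨ shift ⟨
    toℕ x + suc m         ∎
    where
      open ≡-Reasoning
      x<n : toℕ x < n
      x<n = ≤-trans (s≤s (m≤m+n (toℕ x) m)) (subst (_≤ n) (+-suc (toℕ x) m) le)
      shift : toℕ x + suc m ≡ toℕ (next x) + m
      shift = trans (+-suc (toℕ x) m) (cong (_+ m) (sym (next-toℕ x (<⇒≢ x<n))))

  walk-wrap : ∀ m (x : Fin (suc n)) → toℕ x + m ≡ n → walk (suc m) x ≡ zero
  walk-wrap m x eq = begin
    walk (suc m) x   ≡⟨ cong (λ k → walk k x) (+-comm 1 m) ⟩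
    walk (m + 1) x   ≡⟨ walk-+ m 1 x ⟩
    next (walk m x)  ≡⟨ next-last (walk m x) (trans (walk-toℕ m x (≤-reflexive eq)) eq) ⟩
    zero             ∎
    where open ≡-Reasoning

  -- Every position is reached from every other: walk up to the last
  -- position, wrap around to zero, then count up to the target.
  reach : (x y : Fin (suc n)) → Σ ℕ λ m → walk m x ≡ y
  reach x y = suc k + toℕ y , (begin
      walk (suc k + toℕ y) x       ≡⟨ walk-+ (suc k) (toℕ y) x ⟩
      walk (toℕ y) (walk (suc k) x) ≡⟨ cong (walk (toℕ y)) (walk-wrap k x (m+[n∸m]≡n (≤-pred (toℕ<n x)))) ⟩
      walk (toℕ y) zero            ≡⟨ toℕ-injective (walk-toℕ (toℕ y) zero (≤-pred (toℕ<n y))) ⟩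
      y                            ∎)
    where
      open ≡-Reasoning
      k : ℕ
      k = n ∸ toℕ x

  -- Meets T a b: the cyclic interval [a, b) swept by walking forward from
  -- a and stopping just before b contains an element of T.
  data Meets (T : List (Fin (suc n))) : Fin (suc n) → Fin (suc n) → Set where
    start : ∀ {a b} → a ≢ b → a ∈ T → Meets T a b
    later : ∀ {a b} → a ≢ b → Meets T (next a) b → Meets T a b

  Meets-≢ : ∀ {T a b} → Meets T a b → a ≢ b
  Meets-≢ (start ne _) = ne
  Meets-≢ (later ne _) = ne

  Meets-mono : ∀ {T U a b} → (∀ {x} → x ∈ T → x ∈ U) → Meets T a b → Meets U a b
  Meets-mono T⊆U (start ne a∈T) = start ne (T⊆U a∈T)
  Meets-mono T⊆U (later ne m)   = later ne (Meets-mono T⊆U m)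

  module _ (T : List (Fin (suc n))) (j s : Fin (suc n)) (s∈T : s ∈ T) (s≢j : s ≢ j) where

    walk-to-s : ∀ m a → walk m a ≡ s → Meets T a j ⊎ Σ ℕ (λ l → l < m × walk l a ≡ j)
    walk-to-s zero    a eq = inj₁ (start (λ a≡j → s≢j (trans (sym eq) a≡j)) (subst (_∈ T) (sym eq) s∈T))
    walk-to-s (suc m) a eq with a Fin.≟ j
    ... | yes a≡j = inj₂ (0 , s≤s z≤n , a≡j)
    ... | no  a≢j with walk-to-s m (next a) eq
    ...   | inj₁ meets          = inj₁ (later a≢j meets)
    ...   | inj₂ (l , l<m , eq′) = inj₂ (suc l , s≤s l<m , eq′)

    -- Induction on the length of a walk from next j to s: if it passes
    -- through j first, it returns to next j one step later, and the
    -- remaining walk to s is shorter.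
    around-from : ∀ m → walk m (next j) ≡ s → Meets T (next j) j
    around-from = <-rec _ go
      where
        go : ∀ m → (∀ {r} → r < m → walk r (next j) ≡ s → Meets T (next j) j) →
             walk m (next j) ≡ s → Meets T (next j) j
        go m rec eq with walk-to-s m (next j) eq
        ... | inj₁ meets           = meets
        ... | inj₂ (l , l<m , hit) = rec r<m (begin
            walk r (next j)                       ≡⟨ cong (λ y → walk r (next y)) hit ⟨
            walk r (next (walk l (next j)))       ≡⟨ cong (walk r) (walk-+ l 1 (next j)) ⟨
            walk r (walk (l + 1) (next j))        ≡⟨ walk-+ (l + 1) r (next j) ⟨
            walk (l + 1 + r) (next j)             ≡⟨ cong (λ k → walk (k + r) (next j)) (+-comm l 1) ⟩
            walk (suc l + r) (next j)             ≡⟨ cong (λ k → walk k (next j)) (m+[n∸m]≡n l<m) ⟩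
            walk m (next j)                       ≡⟨ eq ⟩
            s                                     ∎)
          where
            open ≡-Reasoning
            r : ℕ
            r = m ∸ suc l
            r<m : r < m
            r<m = subst (r <_) (m+[n∸m]≡n l<m) (s≤s (m≤n+m r l))

    around : Meets T (next j) j
    around = let (m , eq) = reach (next j) s in around-from m eq

  missing : (T : List (Fin (suc n))) → length T < suc n → Σ (Fin (suc n)) λ k → k ∉ T
  missing T lt = ¬∀⟶∃¬ (suc n) (_∈ T) (_∈? T) not-all
    where
      open DecMembership (Fin._≟_ {suc n}) using (_∈?_)
      not-all : ¬ (∀ k → k ∈ T)
      not-all all with pigeonhole lt (λ k → index (all k))
      ... | i , j , i<j , eq = <⇒≢ i<j (cong toℕ (begin
          i                       ≡⟨ lookup-index (all i) ⟩
          lookup T (index (all i)) ≡⟨ cong (lookup T) eq ⟩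
          lookup T (index (all j)) ≡⟨ lookup-index (all j) ⟨
          j                       ∎))
        where open ≡-Reasoning

-- The ring laws of R = F[t]/⟨tˢ⟩ needed for matrix algebra.  Products are
-- convolutions of coefficient sequences; associativity amounts to
-- exchanging the order of summation over a triangle.
module Coefficients (𝔽 : FiniteField) (s d : ℕ) where
  open import Algebra.Bundles using (CommutativeRing)
  open import Data.Nat as ℕ using (ℕ; zero; suc; _∸_; _<_; s≤s)
  open import Data.Nat.Properties as ℕₚ using (≤-pred; ≤-<-trans; m∸n≤m)
  open import Data.Fin using (toℕ; fromℕ; inject₁)
  open import Data.Fin.Properties using (toℕ<n; toℕ-inject₁; toℕ-fromℕ)
  open import Data.List using (map; applyUpTo)
  open import Function using (_∘_; id)
  import Relation.Binary.PropositionalEquality as ≡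
  open ≡ using (_≡_; _≢_)

  open FiniteField 𝔽
  open CommutativeRing ring hiding (zero)
  open Construction 𝔽 s d
  open import Algebra.Properties.Semiring.Sum semiring
    using (sum; sum-cong-≋; sum-cong-≗; ∑-distrib-+; sum-init-last; sum-replicate-zero; *-distribˡ-sum; *-distribʳ-sum)
  open import Relation.Binary.Reasoning.Setoid setoid

  -- Σ< n f = f 0 + … + f (n-1).  It is kept opaque so that the summand f
  -- can be inferred from a sum; the lemmas below are its interface.
  opaque
    Σ< : ℕ → (ℕ → Carrier) → Carrier
    Σ< n f = sum {n} (f ∘ toℕ)

    Σ<-empty : ∀ f → Σ< 0 f ≈ 0#
    Σ<-empty f = refl

    Σ<-cons : ∀ n f → Σ< (suc n) f ≈ f 0 + Σ< n (f ∘ suc)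
    Σ<-cons n f = refl

    Σ<-cong : ∀ n {f g} → (∀ i → i < n → f i ≈ g i) → Σ< n f ≈ Σ< n g
    Σ<-cong n f≈g = sum-cong-≋ {n} (λ i → f≈g (toℕ i) (toℕ<n i))

    Σ<-+ : ∀ n f g → Σ< n (λ i → f i + g i) ≈ Σ< n f + Σ< n g
    Σ<-+ n f g = ∑-distrib-+ {n} (f ∘ toℕ) (g ∘ toℕ)

    Σ<-*ˡ : ∀ n c f → c * Σ< n f ≈ Σ< n (λ i → c * f i)
    Σ<-*ˡ n c f = *-distribˡ-sum {n} c (f ∘ toℕ)

    Σ<-*ʳ : ∀ n c f → Σ< n f * c ≈ Σ< n (λ i → f i * c)
    Σ<-*ʳ n c f = *-distribʳ-sum {n} c (f ∘ toℕ)

    Σ<-zero : ∀ n {f} → (∀ i → i < n → f i ≈ 0#) → Σ< n f ≈ 0#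
    Σ<-zero n f≈0 = trans (Σ<-cong n f≈0) (sum-replicate-zero n)

    Σ<-snoc : ∀ n f → Σ< (suc n) f ≈ Σ< n f + f n
    Σ<-snoc n f = begin
      Σ< (suc n) f                                       ≈⟨ sum-init-last {n} (f ∘ toℕ) ⟩
      sum {n} (f ∘ toℕ ∘ inject₁) + f (toℕ (fromℕ n))    ≡⟨ ≡.cong₂ _+_ (sum-cong-≗ {n} (≡.cong f ∘ toℕ-inject₁)) (≡.cong f (toℕ-fromℕ n)) ⟩
      Σ< n f + f n                                       ∎

    convolution : ∀ a b k → (a *R b) k ≈ Σ< (suc k) (λ i → a i * b (k ∸ i))
    convolution a b k = reflexive (sumF-applyUpTo (λ i → a i * b (k ∸ i)) id (suc k))
      where
        sumF-applyUpTo : ∀ (f : ℕ → Carrier) g n → sumF (map f (applyUpTo g n)) ≡ Σ< n (f ∘ g)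
        sumF-applyUpTo f g zero    = ≡.refl
        sumF-applyUpTo f g (suc n) = ≡.cong (f (g 0) +_) (sumF-applyUpTo f (g ∘ suc) n)

  Σ<-length : ∀ {m n f} → m ≡ n → Σ< m f ≈ Σ< n f
  Σ<-length {f = f} m≡n = reflexive (≡.cong (λ m → Σ< m f) m≡n)

  triangle : ∀ (F : ℕ → ℕ → Carrier) n →
    Σ< n (λ m → Σ< (suc m) (λ i → F i m)) ≈ Σ< n (λ i → Σ< (n ∸ i) (λ j → F i (i ℕ.+ j)))
  triangle F zero    = trans (Σ<-empty _) (sym (Σ<-empty _))
  triangle F (suc n) = begin
      Σ< (suc n) (λ m → Σ< (suc m) (λ i → F i m))
    ≈⟨ Σ<-snoc n _ ⟩
      Σ< n (λ m → Σ< (suc m) (λ i → F i m)) + Σ< (suc n) (λ i → F i n)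
    ≈⟨ +-congʳ (triangle F n) ⟩
      Σ< n rows + Σ< (suc n) (λ i → F i n)
    ≈⟨ +-congʳ rows-extend ⟨
      Σ< (suc n) rows + Σ< (suc n) (λ i → F i n)
    ≈⟨ Σ<-+ (suc n) rows (λ i → F i n) ⟨
      Σ< (suc n) (λ i → rows i + F i n)
    ≈⟨ Σ<-cong (suc n) row-step ⟩
      Σ< (suc n) (λ i → Σ< (suc n ∸ i) (λ j → F i (i ℕ.+ j)))  ∎
    where
      rows : ℕ → Carrier
      rows i = Σ< (n ∸ i) (λ j → F i (i ℕ.+ j))
      -- the row i = n of the smaller triangle is empty
      rows-extend : Σ< (suc n) rows ≈ Σ< n rows
      rows-extend = trans (Σ<-snoc n rows)
        (trans (+-congˡ (trans (Σ<-length (ℕₚ.n∸n≡0 n)) (Σ<-empty _))) (+-identityʳ _))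
      -- the new column m = n adds the entry F i n to row i
      row-step : ∀ i → i < suc n → rows i + F i n ≈ Σ< (suc n ∸ i) (λ j → F i (i ℕ.+ j))
      row-step i i≤n = begin
          rows i + F i n
        ≡⟨ ≡.cong (λ m → rows i + F i m) (ℕₚ.m+[n∸m]≡n (≤-pred i≤n)) ⟨
          rows i + F i (i ℕ.+ (n ∸ i))
        ≈⟨ Σ<-snoc (n ∸ i) (λ j → F i (i ℕ.+ j)) ⟨
          Σ< (suc (n ∸ i)) (λ j → F i (i ℕ.+ j))
        ≈⟨ Σ<-length (ℕₚ.+-∸-assoc 1 (≤-pred i≤n)) ⟨
          Σ< (suc n ∸ i) (λ j → F i (i ℕ.+ j))  ∎

  *R-cong : ∀ {a a′ b b′} → a ≈R a′ → b ≈R b′ → (a *R b) ≈R (a′ *R b′)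
  *R-cong {a} {a′} {b} {b′} a≈ b≈ k k<s = begin
    (a *R b) k                              ≈⟨ convolution a b k ⟩
    Σ< (suc k) (λ i → a i * b (k ∸ i))      ≈⟨ Σ<-cong (suc k) termwise ⟩
    Σ< (suc k) (λ i → a′ i * b′ (k ∸ i))    ≈⟨ convolution a′ b′ k ⟨
    (a′ *R b′) k                            ∎
    where
      -- only coefficients of degree ≤ k < s enter
      termwise : ∀ i → i < suc k → a i * b (k ∸ i) ≈ a′ i * b′ (k ∸ i)
      termwise i i≤k = *-cong (a≈ i (≤-<-trans (≤-pred i≤k) k<s)) (b≈ (k ∸ i) (≤-<-trans (m∸n≤m k i) k<s))

  *R-assoc : ∀ a b c → ((a *R b) *R c) ≈R (a *R (b *R c))
  *R-assoc a b c k _ = begin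
      ((a *R b) *R c) k
    ≈⟨ convolution (a *R b) c k ⟩
      Σ< (suc k) (λ m → (a *R b) m * c (k ∸ m))
    ≈⟨ Σ<-cong (suc k) (λ m _ → trans (*-congʳ (convolution a b m)) (Σ<-*ʳ (suc m) (c (k ∸ m)) _)) ⟩
      Σ< (suc k) (λ m → Σ< (suc m) (λ i → a i * b (m ∸ i) * c (k ∸ m)))
    ≈⟨ triangle (λ i m → a i * b (m ∸ i) * c (k ∸ m)) (suc k) ⟩
      Σ< (suc k) (λ i → Σ< (suc k ∸ i) (λ j → a i * b (i ℕ.+ j ∸ i) * c (k ∸ (i ℕ.+ j))))
    ≈⟨ Σ<-cong (suc k) inner ⟩
      Σ< (suc k) (λ i → a i * (b *R c) (k ∸ i))
    ≈⟨ convolution a (b *R c) k ⟨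
      (a *R (b *R c)) k  ∎
    where
      inner : ∀ i → i < suc k →
        Σ< (suc k ∸ i) (λ j → a i * b (i ℕ.+ j ∸ i) * c (k ∸ (i ℕ.+ j))) ≈ a i * (b *R c) (k ∸ i)
      inner i i≤k = begin
          Σ< (suc k ∸ i) (λ j → a i * b (i ℕ.+ j ∸ i) * c (k ∸ (i ℕ.+ j)))
        ≈⟨ Σ<-length (ℕₚ.+-∸-assoc 1 (≤-pred i≤k)) ⟩
          Σ< (suc (k ∸ i)) (λ j → a i * b (i ℕ.+ j ∸ i) * c (k ∸ (i ℕ.+ j)))
        ≈⟨ Σ<-cong (suc (k ∸ i)) (λ j _ → trans (*-assoc _ _ _)
             (*-congˡ (*-cong (reflexive (≡.cong b (ℕₚ.m+n∸m≡n i j)))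
                              (reflexive (≡.cong c (≡.sym (ℕₚ.∸-+-assoc k i j))))))) ⟩
          Σ< (suc (k ∸ i)) (λ j → a i * (b j * c (k ∸ i ∸ j)))
        ≈⟨ Σ<-*ˡ (suc (k ∸ i)) (a i) _ ⟨
          a i * Σ< (suc (k ∸ i)) (λ j → b j * c (k ∸ i ∸ j))
        ≈⟨ *-congˡ (convolution b c (k ∸ i)) ⟨
          a i * (b *R c) (k ∸ i)  ∎

  *R-distribˡ : ∀ a b c → (a *R (b +R c)) ≈R ((a *R b) +R (a *R c))
  *R-distribˡ a b c k _ = begin
    (a *R (b +R c)) k                                   ≈⟨ convolution a (b +R c) k ⟩
    Σ< (suc k) (λ i → a i * (b (k ∸ i) + c (k ∸ i)))     ≈⟨ Σ<-cong (suc k) (λ i _ → distribˡ (a i) _ _) ⟩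
    Σ< (suc k) (λ i → a i * b (k ∸ i) + a i * c (k ∸ i)) ≈⟨ Σ<-+ (suc k) _ _ ⟩
    Σ< (suc k) (λ i → a i * b (k ∸ i)) + Σ< (suc k) (λ i → a i * c (k ∸ i))
                                                        ≈⟨ +-cong (convolution a b k) (convolution a c k) ⟨
    ((a *R b) +R (a *R c)) k                            ∎

  *R-distribʳ : ∀ a b c → ((b +R c) *R a) ≈R ((b *R a) +R (c *R a))
  *R-distribʳ a b c k _ = begin
    ((b +R c) *R a) k                                   ≈⟨ convolution (b +R c) a k ⟩
    Σ< (suc k) (λ i → (b i + c i) * a (k ∸ i))           ≈⟨ Σ<-cong (suc k) (λ i _ → distribʳ (a (k ∸ i)) _ _) ⟩
    Σ< (suc k) (λ i → b i * a (k ∸ i) + c i * a (k ∸ i)) ≈⟨ Σ<-+ (suc k) _ _ ⟩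
    Σ< (suc k) (λ i → b i * a (k ∸ i)) + Σ< (suc k) (λ i → c i * a (k ∸ i))
                                                        ≈⟨ +-cong (convolution b a k) (convolution c a k) ⟨
    ((b *R a) +R (c *R a)) k                            ∎

  *R-zeroˡ : ∀ a → (0R *R a) ≈R 0R
  *R-zeroˡ a k _ = trans (convolution 0R a k) (Σ<-zero (suc k) (λ i _ → zeroˡ _))

  *R-zeroʳ : ∀ a → (a *R 0R) ≈R 0R
  *R-zeroʳ a k _ = trans (convolution a 0R k) (Σ<-zero (suc k) (λ i _ → zeroʳ _))

  *R-identityˡ : ∀ a → (1R *R a) ≈R a
  *R-identityˡ a k _ = begin
    (1R *R a) k                              ≈⟨ trans (convolution 1R a k) (Σ<-cons k _) ⟩
    1# * a k + Σ< k (λ i → 0# * a (k ∸ suc i)) ≈⟨ +-cong (*-identityˡ _) (Σ<-zero k (λ i _ → zeroˡ _)) ⟩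
    a k + 0#                                 ≈⟨ +-identityʳ _ ⟩
    a k                                      ∎

  *R-identityʳ : ∀ a → (a *R 1R) ≈R a
  *R-identityʳ a k _ = begin
    (a *R 1R) k                                      ≈⟨ convolution a 1R k ⟩
    Σ< (suc k) (λ i → a i * 1R (k ∸ i))               ≈⟨ Σ<-snoc k _ ⟩
    Σ< k (λ i → a i * 1R (k ∸ i)) + a k * 1R (k ∸ k)  ≈⟨ +-cong (Σ<-zero k (λ i i<k → trans (*-congˡ (reflexive (1R-positive i<k))) (zeroʳ _)))
                                                               (trans (*-congˡ (reflexive (≡.cong 1R (ℕₚ.n∸n≡0 k)))) (*-identityʳ _)) ⟩
    0# + a k                                         ≈⟨ +-identityˡ _ ⟩
    a k                                              ∎
    where
      1R-positive : ∀ {i k} → i < k → 1R (k ∸ i) ≡ 0#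
      1R-positive {zero}  {suc k} _         = ≡.refl
      1R-positive {suc i} {suc k} (s≤s i<k) = 1R-positive i<k

module Matrices (𝔽 : FiniteField) (s d : ℕ) where
  open import Level using (0ℓ)
  open import Algebra.Bundles using (CommutativeRing)
  open import Data.Nat using (ℕ; zero; suc)
  open import Data.Fin as Fin using (Fin; zero; suc; punchIn; punchOut)
  open import Data.Fin.Properties using (punchInᵢ≢i; punchIn-punchOut; punchIn-injective)
  open import Data.List using (List; []; _∷_; map; tabulate; allFin)
  open import Data.Empty using (⊥-elim)
  open import Relation.Nullary using (Dec; yes; no)
  open import Relation.Binary.Bundles using (Setoid)
  import Relation.Binary.PropositionalEquality as ≡
  open ≡ using (_≡_; _≢_)

  open FiniteField 𝔽
  open CommutativeRing ring hiding (zero)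
  open Construction 𝔽 s d
  open Coefficients 𝔽 s d
  open import Algebra.Properties.Semiring.Sum semiring using (sum; sum-cong-≋; sum-cong-≗; ∑-comm; sum-remove; sum-replicate-zero)
  open import Relation.Binary.Reasoning.Setoid setoid

  ≈R-refl : ∀ {a} → a ≈R a
  ≈R-refl k _ = refl

  ≈R-sym : ∀ {a b} → a ≈R b → b ≈R a
  ≈R-sym a≈b k k<s = sym (a≈b k k<s)

  ≈R-trans : ∀ {a b c} → a ≈R b → b ≈R c → a ≈R c
  ≈R-trans a≈b b≈c k k<s = trans (a≈b k k<s) (b≈c k k<s)

  +R-cong : ∀ {a a′ b b′} → a ≈R a′ → b ≈R b′ → (a +R b) ≈R (a′ +R b′)
  +R-cong a≈ b≈ k k<s = +-cong (a≈ k k<s) (b≈ k k<s)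

  M-refl : ∀ {A} → A ≈M A
  M-refl i j = ≈R-refl

  M-sym : ∀ {A B} → A ≈M B → B ≈M A
  M-sym A≈B i j = ≈R-sym (A≈B i j)

  M-trans : ∀ {A B C} → A ≈M B → B ≈M C → A ≈M C
  M-trans A≈B B≈C i j = ≈R-trans (A≈B i j) (B≈C i j)

  MatSetoid : Setoid 0ℓ 0ℓ
  MatSetoid = record { Carrier = Mat ; _≈_ = _≈M_
                     ; isEquivalence = record { refl = M-refl ; sym = M-sym ; trans = M-trans } }

  sum-delta : ∀ {n} (f : Fin n → Carrier) a → (∀ l → l ≢ a → f l ≈ 0#) → sum f ≈ f a
  sum-delta {suc n} f a off = begin
    sum f                                ≈⟨ sum-remove {i = a} f ⟩
    f a + sum (λ l → f (punchIn a l))    ≈⟨ +-congˡ (trans (sum-cong-≋ (λ l → off (punchIn a l) (punchInᵢ≢i a l))) (sum-replicate-zero n)) ⟩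
    f a + 0#                             ≈⟨ +-identityʳ _ ⟩
    f a                                  ∎

  sum-two : ∀ {n} (f : Fin n → Carrier) a c → a ≢ c →
            (∀ l → l ≢ a → l ≢ c → f l ≈ 0#) → sum f ≈ f a + f c
  sum-two {suc n} f a c a≢c off = begin
    sum f                              ≈⟨ sum-remove {i = a} f ⟩
    f a + sum (λ l → f (punchIn a l))  ≈⟨ +-congˡ (sum-delta (λ l → f (punchIn a l)) c′ off′) ⟩
    f a + f (punchIn a c′)             ≡⟨ ≡.cong (λ x → f a + f x) (punchIn-punchOut a≢c) ⟩
    f a + f c                          ∎
    where
      c′ : Fin n
      c′ = punchOut a≢c
      off′ : ∀ l → l ≢ c′ → f (punchIn a l) ≈ 0#
      off′ l l≢c′ = off (punchIn a l) (punchInᵢ≢i a l)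
        (λ eq → l≢c′ (punchIn-injective a l c′ (≡.trans eq (≡.sym (punchIn-punchOut a≢c)))))

  sumR-tabulate : ∀ {n} {X : Set} (f : X → R) (g : Fin n → X) k →
                  sumR (map f (tabulate g)) k ≡ sum (λ l → f (g l) k)
  sumR-tabulate {zero}  f g k = ≡.refl
  sumR-tabulate {suc n} f g k = ≡.cong (f (g zero) k +_) (sumR-tabulate f (λ l → g (suc l)) k)

  product-entry : ∀ A B i j k → (A · B) i j k ≡ sum (λ l → (A i l *R B l j) k)
  product-entry A B i j k = sumR-tabulate (λ l → A i l *R B l j) (λ l → l) k

  sumR-*ʳ : {X : Set} (xs : List X) (f : X → R) (c : R) → (sumR (map f xs) *R c) ≈R sumR (map (λ x → f x *R c) xs)
  sumR-*ʳ []       f c = *R-zeroˡ c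
  sumR-*ʳ (x ∷ xs) f c = ≈R-trans (*R-distribʳ c (f x) _) (+R-cong ≈R-refl (sumR-*ʳ xs f c))

  sumR-*ˡ : {X : Set} (xs : List X) (f : X → R) (c : R) → (c *R sumR (map f xs)) ≈R sumR (map (λ x → c *R f x) xs)
  sumR-*ˡ []       f c = *R-zeroʳ c
  sumR-*ˡ (x ∷ xs) f c = ≈R-trans (*R-distribˡ c (f x) _) (+R-cong ≈R-refl (sumR-*ˡ xs f c))

  ·-assoc : ∀ A B C → ((A · B) · C) ≈M (A · (B · C))
  ·-assoc A B C i j k k<s = begin
      ((A · B) · C) i j k
    ≡⟨ product-entry (A · B) C i j k ⟩
      sum (λ l → ((A · B) i l *R C l j) k)
    ≈⟨ sum-cong-≋ (λ l → trans (sumR-*ʳ (allFin d) (λ m → A i m *R B m l) (C l j) k k<s)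
                                 (reflexive (sumR-tabulate (λ m → (A i m *R B m l) *R C l j) (λ m → m) k))) ⟩
      sum (λ l → sum (λ m → ((A i m *R B m l) *R C l j) k))
    ≈⟨ sum-cong-≋ (λ l → sum-cong-≋ (λ m → *R-assoc (A i m) (B m l) (C l j) k k<s)) ⟩
      sum (λ l → sum (λ m → (A i m *R (B m l *R C l j)) k))
    ≈⟨ ∑-comm (λ l m → (A i m *R (B m l *R C l j)) k) ⟩
      sum (λ m → sum (λ l → (A i m *R (B m l *R C l j)) k))
    ≈⟨ sum-cong-≋ (λ m → sym (trans (sumR-*ˡ (allFin d) (λ l → B m l *R C l j) (A i m) k k<s)
                                      (reflexive (sumR-tabulate (λ l → A i m *R (B m l *R C l j)) (λ l → l) k)))) ⟩
      sum (λ m → (A i m *R (B · C) m j) k)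
    ≡⟨ product-entry A (B · C) i j k ⟨
      (A · (B · C)) i j k  ∎

  ·-cong : ∀ {A A′ B B′} → A ≈M A′ → B ≈M B′ → (A · B) ≈M (A′ · B′)
  ·-cong {A} {A′} {B} {B′} A≈ B≈ i j k k<s = begin
    (A · B) i j k                       ≡⟨ product-entry A B i j k ⟩
    sum (λ l → (A i l *R B l j) k)      ≈⟨ sum-cong-≋ (λ l → *R-cong (A≈ i l) (B≈ l j) k k<s) ⟩
    sum (λ l → (A′ i l *R B′ l j) k)    ≡⟨ product-entry A′ B′ i j k ⟨
    (A′ · B′) i j k                     ∎

  ·-congˡ : ∀ C {A B} → A ≈M B → (C · A) ≈M (C · B)
  ·-congˡ C = ·-cong M-refl

  ·-congʳ : ∀ C {A B} → A ≈M B → (A · C) ≈M (B · C)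
  ·-congʳ C A≈B = ·-cong A≈B M-refl

  I-diag : ∀ i → I i i ≡ 1R
  I-diag i with i Fin.≟ i
  ... | yes _ = ≡.refl
  ... | no ne = ⊥-elim (ne ≡.refl)

  I-off : ∀ {i l} → i ≢ l → I i l ≡ 0R
  I-off {i} {l} ne with i Fin.≟ l
  ... | yes eq = ⊥-elim (ne eq)
  ... | no _   = ≡.refl

  I-identityˡ : ∀ A → (I · A) ≈M A
  I-identityˡ A a b k k<s = begin
    (I · A) a b k                   ≡⟨ product-entry I A a b k ⟩
    sum (λ l → (I a l *R A l b) k)  ≈⟨ sum-delta _ a off-diagonal ⟩
    (I a a *R A a b) k              ≡⟨ ≡.cong (λ x → (x *R A a b) k) (I-diag a) ⟩
    (1R *R A a b) k                 ≈⟨ *R-identityˡ (A a b) k k<s ⟩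
    A a b k                         ∎
    where
      off-diagonal : ∀ l → l ≢ a → (I a l *R A l b) k ≈ 0#
      off-diagonal l l≢a = trans (reflexive (≡.cong (λ x → (x *R A l b) k) (I-off (λ a≡l → l≢a (≡.sym a≡l)))))
                                 (*R-zeroˡ (A l b) k k<s)

  I-identityʳ : ∀ A → (A · I) ≈M A
  I-identityʳ A a b k k<s = begin
    (A · I) a b k                   ≡⟨ product-entry A I a b k ⟩
    sum (λ l → (A a l *R I l b) k)  ≈⟨ sum-delta _ b off-diagonal ⟩
    (A a b *R I b b) k              ≡⟨ ≡.cong (λ x → (A a b *R x) k) (I-diag b) ⟩
    (A a b *R 1R) k                 ≈⟨ *R-identityʳ (A a b) k k<s ⟩
    A a b k                         ∎
    where
      off-diagonal : ∀ l → l ≢ b → (A a l *R I l b) k ≈ 0#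
      off-diagonal l l≢b = trans (reflexive (≡.cong (λ x → (A a l *R x) k) (I-off l≢b))) (*R-zeroʳ (A a l) k k<s)

  e-diag : ∀ {i j r} a → e i j r a a ≡ 1R
  e-diag a with a Fin.≟ a
  ... | yes _  = ≡.refl
  ... | no a≢a = ⊥-elim (a≢a ≡.refl)

  e-off-pivot-row : ∀ {i j r a b} → a ≢ b → a ≢ i → e i j r a b ≡ 0R
  e-off-pivot-row {i} {j} {r} {a} {b} a≢b a≢i with a Fin.≟ b | a Fin.≟ i | b Fin.≟ j
  ... | yes a≡b | _       | _ = ⊥-elim (a≢b a≡b)
  ... | no _    | yes a≡i | _ = ⊥-elim (a≢i a≡i)
  ... | no _    | no _    | _ = ≡.refl

  e-other-row : ∀ {i j r a} b → a ≢ i → e i j r a b ≡ I a b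
  e-other-row {i} {j} {r} {a} b a≢i = by-cases (a Fin.≟ b)
    where
      by-cases : Dec (a ≡ b) → e i j r a b ≡ I a b
      by-cases (yes ≡.refl) = ≡.trans (e-diag a) (≡.sym (I-diag a))
      by-cases (no a≢b)     = ≡.trans (e-off-pivot-row a≢b a≢i) (≡.sym (I-off a≢b))

  e-pivot : ∀ {i j r} → i ≢ j → e i j r i j ≡ r
  e-pivot {i} {j} i≢j with i Fin.≟ j | i Fin.≟ i | j Fin.≟ j
  ... | yes i≡j | _      | _      = ⊥-elim (i≢j i≡j)
  ... | no _    | yes _  | yes _  = ≡.refl
  ... | no _    | no i≢i | _      = ⊥-elim (i≢i ≡.refl)
  ... | no _    | yes _  | no j≢j = ⊥-elim (j≢j ≡.refl)

  e-pivot-row : ∀ {i j r b} → i ≢ b → b ≢ j → e i j r i b ≡ 0R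
  e-pivot-row {i} {j} {r} {b} i≢b b≢j with i Fin.≟ b | i Fin.≟ i | b Fin.≟ j
  ... | yes i≡b | _      | _       = ⊥-elim (i≢b i≡b)
  ... | no _    | yes _  | yes b≡j = ⊥-elim (b≢j b≡j)
  ... | no _    | yes _  | no _    = ≡.refl
  ... | no _    | no i≢i | _       = ⊥-elim (i≢i ≡.refl)

  row-op-other : ∀ {i j} r A {a} b → a ≢ i → (e i j r · A) a b ≈R A a b
  row-op-other {i} {j} r A {a} b a≢i k k<s = begin
    (e i j r · A) a b k                   ≡⟨ product-entry (e i j r) A a b k ⟩
    sum (λ l → (e i j r a l *R A l b) k)  ≡⟨ sum-cong-≗ (λ l → ≡.cong (λ x → (x *R A l b) k) (e-other-row l a≢i)) ⟩
    sum (λ l → (I a l *R A l b) k)        ≡⟨ product-entry I A a b k ⟨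
    (I · A) a b k                         ≈⟨ I-identityˡ A a b k k<s ⟩
    A a b k                               ∎

  row-op-pivot : ∀ {i j} r A b → i ≢ j → (e i j r · A) i b ≈R (A i b +R (r *R A j b))
  row-op-pivot {i} {j} r A b i≢j k k<s = begin
      (e i j r · A) i b k
    ≡⟨ product-entry (e i j r) A i b k ⟩
      sum (λ l → (e i j r i l *R A l b) k)
    ≈⟨ sum-two _ i j i≢j (λ l l≢i l≢j → trans (reflexive (≡.cong (λ x → (x *R A l b) k)
                                                  (e-pivot-row (λ i≡l → l≢i (≡.sym i≡l)) l≢j)))
                                               (*R-zeroˡ (A l b) k k<s)) ⟩
      (e i j r i i *R A i b) k + (e i j r i j *R A j b) k
    ≡⟨ ≡.cong₂ (λ x y → (x *R A i b) k + (y *R A j b) k) (e-diag i) (e-pivot i≢j) ⟩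
      (1R *R A i b) k + (r *R A j b) k
    ≈⟨ +-congʳ (*R-identityˡ (A i b) k k<s) ⟩
      (A i b +R (r *R A j b)) k  ∎

  e-inverse : ∀ {i j} r r′ → i ≢ j → (r +R r′) ≈R 0R → (e i j r · e i j r′) ≈M I
  e-inverse {i} {j} r r′ i≢j r+r′≈0 a b = by-row (a Fin.≟ i)
    where
      j≢i : j ≢ i
      j≢i j≡i = i≢j (≡.sym j≡i)
      row-j : ∀ b → e i j r′ j b ≡ I j b
      row-j b = e-other-row b j≢i
      by-row : Dec (a ≡ i) → (e i j r · e i j r′) a b ≈R I a b
      by-row (no a≢i)     k k<s = trans (row-op-other r (e i j r′) b a≢i k k<s)
                                          (reflexive (≡.cong (λ x → x k) (e-other-row b a≢i)))
      by-row (yes ≡.refl) = ≈R-trans (row-op-pivot r (e i j r′) b i≢j) (pivot-row (b Fin.≟ i) (b Fin.≟ j))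
        where
          pivot-row : Dec (b ≡ i) → Dec (b ≡ j) → (e i j r′ i b +R (r *R e i j r′ j b)) ≈R I i b
          pivot-row (yes ≡.refl) _ k k<s = begin
            e b j r′ b b k + (r *R e b j r′ j b) k  ≡⟨ ≡.cong₂ (λ x y → x k + (r *R y) k) (e-diag b) (≡.trans (row-j b) (I-off j≢i)) ⟩
            1R k + (r *R 0R) k                      ≈⟨ +-congˡ (*R-zeroʳ r k k<s) ⟩
            1R k + 0#                               ≈⟨ +-identityʳ _ ⟩
            1R k                                    ≡⟨ ≡.cong (λ x → x k) (I-diag b) ⟨
            I b b k                                 ∎
          pivot-row (no _) (yes ≡.refl) k k<s = begin
            e i b r′ i b k + (r *R e i b r′ b b) k  ≡⟨ ≡.cong₂ (λ x y → x k + (r *R y) k) (e-pivot i≢j) (e-diag b) ⟩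
            r′ k + (r *R 1R) k                      ≈⟨ +-congˡ (*R-identityʳ r k k<s) ⟩
            r′ k + r k                              ≈⟨ +-comm _ _ ⟩
            r k + r′ k                              ≈⟨ r+r′≈0 k k<s ⟩
            0#                                      ≡⟨ ≡.cong (λ x → x k) (I-off i≢j) ⟨
            I i b k                                 ∎
          pivot-row (no b≢i) (no b≢j) k k<s = begin
            e i j r′ i b k + (r *R e i j r′ j b) k  ≡⟨ ≡.cong₂ (λ x y → x k + (r *R y) k) (e-pivot-row i≢b b≢j) (≡.trans (row-j b) (I-off (λ j≡b → b≢j (≡.sym j≡b)))) ⟩
            0# + (r *R 0R) k                        ≈⟨ +-identityˡ _ ⟩
            (r *R 0R) k                             ≈⟨ *R-zeroʳ r k k<s ⟩
            0#                                      ≡⟨ ≡.cong (λ x → x k) (I-off i≢b) ⟨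
            I i b k                                 ∎
            where
              i≢b : i ≢ b
              i≢b i≡b = b≢i (≡.sym i≡b)

module GeneratedSubgroups (𝔽 : FiniteField) (s d : ℕ) where
  open import Data.Nat using (ℕ)
  open import Data.Product using (Σ; _×_; _,_)

  open Construction 𝔽 s d
  open Matrices 𝔽 s d
  open import Relation.Binary.Reasoning.Setoid MatSetoid

  left-inverse-unique : ∀ {g h g′} → (h · g) ≈M I → (g · g′) ≈M I → h ≈M g′
  left-inverse-unique {g} {h} {g′} hg≈I gg′≈I = begin
    h               ≈⟨ I-identityʳ h ⟨
    h · I           ≈⟨ ·-congˡ h gg′≈I ⟨
    h · (g · g′)    ≈⟨ ·-assoc h g g′ ⟨
    (h · g) · g′    ≈⟨ ·-congʳ g′ hg≈I ⟩
    I · g′          ≈⟨ I-identityˡ g′ ⟩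
    g′              ∎

  cancel-middle : ∀ A B C D → (B · C) ≈M I → (A · D) ≈M I → ((A · B) · (C · D)) ≈M I
  cancel-middle A B C D BC≈I AD≈I = begin
    (A · B) · (C · D)   ≈⟨ ·-assoc A B (C · D) ⟩
    A · (B · (C · D))   ≈⟨ ·-congˡ A (·-assoc B C D) ⟨
    A · ((B · C) · D)   ≈⟨ ·-congˡ A (·-congʳ D BC≈I) ⟩
    A · (I · D)         ≈⟨ ·-congˡ A (I-identityˡ D) ⟩
    A · D               ≈⟨ AD≈I ⟩
    I                   ∎

  module _ {P : Mat → Set} where

    generator-∈ : ∀ {g} → P g → ⟨ P ⟩ g
    generator-∈ p = g-resp (I-identityʳ _) (g-gen p g-id)

    ·-closed : ∀ {A B} → ⟨ P ⟩ A → ⟨ P ⟩ B → ⟨ P ⟩ (A · B)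
    ·-closed g-id           B∈ = g-resp (M-sym (I-identityˡ _)) B∈
    ·-closed (g-gen p A∈)   B∈ = g-resp (M-sym (·-assoc _ _ _)) (g-gen p (·-closed A∈ B∈))
    ·-closed (g-inv p e A∈) B∈ = g-resp (M-sym (·-assoc _ _ _)) (g-inv p e (·-closed A∈ B∈))
    ·-closed (g-resp e A∈)  B∈ = g-resp (·-congʳ _ e) (·-closed A∈ B∈)

    Invertible : Mat → Set
    Invertible g = Σ Mat λ g′ → ⟨ P ⟩ g′ × (g · g′) ≈M I × (g′ · g) ≈M I

    module _ (generator-inverse : ∀ {g} → P g → Invertible g) where

      invertible : ∀ {M} → ⟨ P ⟩ M → Invertible M
      invertible g-id = I , g-id , I-identityˡ I , I-identityˡ I
      invertible (g-gen {g} {M} p M∈) with generator-inverse p | invertible M∈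
      ... | g′ , g′∈ , gg′ , g′g | M′ , M′∈ , MM′ , M′M =
        M′ · g′ , ·-closed M′∈ g′∈ , cancel-middle g M M′ g′ MM′ gg′ , cancel-middle M′ g′ g M g′g M′M
      invertible (g-inv {g} {h} {M} p hg M∈) with generator-inverse p | invertible M∈
      ... | g′ , g′∈ , gg′ , g′g | M′ , M′∈ , MM′ , M′M =
        M′ · g , ·-closed M′∈ (generator-∈ p) , cancel-middle h M M′ g MM′ hg ,
        cancel-middle M′ g h M (M-trans (·-congˡ g (left-inverse-unique hg gg′)) gg′) M′M
      invertible (g-resp M≈N M∈) with invertible M∈
      ... | M′ , M′∈ , MM′ , M′M = M′ , M′∈ , M-trans (·-congʳ M′ (M-sym M≈N)) MM′ ,
                                               M-trans (·-congˡ M′ (M-sym M≈N)) M′M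

      left-inverse-∈ : ∀ {g h} → ⟨ P ⟩ g → (h · g) ≈M I → ⟨ P ⟩ h
      left-inverse-∈ g∈ hg≈I with invertible g∈
      ... | g′ , g′∈ , gg′ , _ = g-resp (M-sym (left-inverse-unique hg≈I gg′)) g′∈

  ⟨⟩-mono : ∀ {P Q : Mat → Set} → (∀ {g} → P g → Q g) → ∀ {M} → ⟨ P ⟩ M → ⟨ Q ⟩ M
  ⟨⟩-mono P⊆Q g-id           = g-id
  ⟨⟩-mono P⊆Q (g-gen p M∈)   = g-gen (P⊆Q p) (⟨⟩-mono P⊆Q M∈)
  ⟨⟩-mono P⊆Q (g-inv p e M∈) = g-inv (P⊆Q p) e (⟨⟩-mono P⊆Q M∈)
  ⟨⟩-mono P⊆Q (g-resp e M∈)  = g-resp e (⟨⟩-mono P⊆Q M∈)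

module ElementarySubgroups (𝔽 : FiniteField) (s n : ℕ) where
  open import Algebra.Bundles using (CommutativeRing)
  open import Data.Nat using (ℕ; zero; suc; s≤s; z≤n)
  open import Data.Fin as Fin using (Fin)
  open import Data.List using (List; []; _∷_; [_])
  open import Data.List.Relation.Unary.Any using (here; there)
  open import Data.List.Membership.Propositional using (_∈_; _∉_)
  open import Data.Product using (Σ; _×_; _,_)
  open import Data.Sum using (_⊎_; inj₁; inj₂)
  open import Data.Empty using (⊥-elim)
  open import Relation.Nullary using (Dec; yes; no)
  import Relation.Binary.PropositionalEquality as ≡
  open ≡ using (_≡_; _≢_)

  open FiniteField 𝔽
  open CommutativeRing ring hiding (zero)
  d : ℕ
  d = suc (suc n)
  open Construction 𝔽 s d
  open Coefficients 𝔽 s d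
  open Matrices 𝔽 s d
  open GeneratedSubgroups 𝔽 s d
  open CyclicOrder (suc n)

  j≢next-j : ∀ (j : Fin d) → j ≢ next j
  j≢next-j j j≡next = next-≢ (s≤s z≤n) j (≡.sym j≡next)

  E : Fin d → Carrier → Carrier → Mat
  E j a b = e j (next j) (lin a b)

  Gen : (Fin d → Set) → Mat → Set
  Gen C M = Σ (Fin d) λ j → C j × Σ Carrier λ a → Σ Carrier λ b → M ≈M E j a b

  H : List (Fin d) → Mat → Set
  H T = ⟨ Gen (_∉ T) ⟩

  lin-cancel : ∀ {a b a′ b′} → a + a′ ≈ 0# → b + b′ ≈ 0# → (lin a b +R lin a′ b′) ≈R 0R
  lin-cancel _  b≈ zero          _ = b≈
  lin-cancel a≈ _  (suc zero)    _ = a≈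
  lin-cancel _  _  (suc (suc k)) _ = +-identityˡ 0#

  E-inverseʳ : ∀ j a b → (E j a b · E j (- a) (- b)) ≈M I
  E-inverseʳ j a b = e-inverse _ _ (j≢next-j j) (lin-cancel (-‿inverseʳ a) (-‿inverseʳ b))

  E-inverseˡ : ∀ j a b → (E j (- a) (- b) · E j a b) ≈M I
  E-inverseˡ j a b = e-inverse _ _ (j≢next-j j) (lin-cancel (-‿inverseˡ a) (-‿inverseˡ b))

  module _ {C : Fin d → Set} where

    generator-invertible : ∀ {g} → Gen C g → Invertible {Gen C} g
    generator-invertible (j , j∈C , a , b , g≈E) =
      E j (- a) (- b) , generator-∈ (j , j∈C , - a , - b , M-refl) ,
      M-trans (·-congʳ _ g≈E) (E-inverseʳ j a b) , M-trans (·-congˡ _ g≈E) (E-inverseˡ j a b)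

    gen-induction : (Q : Mat → Set) → (∀ {M N} → M ≈M N → Q M → Q N) → Q I →
      (∀ {j a b M} → C j → ⟨ Gen C ⟩ M → Q M → Q (E j a b · M)) →
      ∀ {M} → ⟨ Gen C ⟩ M → Q M
    gen-induction Q Q-resp Q-I Q-step = go
      where
        go : ∀ {M} → ⟨ Gen C ⟩ M → Q M
        go g-id = Q-I
        go (g-gen (j , j∈C , _ , _ , g≈E) M∈) =
          Q-resp (·-congʳ _ (M-sym g≈E)) (Q-step j∈C M∈ (go M∈))
        go (g-inv {h = h} (j , j∈C , a , b , g≈E) hg≈I M∈) =
          Q-resp (·-congʳ _ (M-sym h≈E⁻¹)) (Q-step j∈C M∈ (go M∈))
          where
            h≈E⁻¹ : h ≈M E j (- a) (- b)
            h≈E⁻¹ = left-inverse-unique (M-trans (·-congˡ _ (M-sym g≈E)) hg≈I) (E-inverseʳ j a b)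
        go (g-resp M≈N M∈) = Q-resp M≈N (go M∈)

  VanishesOn : List (Fin d) → Mat → Set
  VanishesOn T M = ∀ {a b} → Meets T a b → M a b ≈R 0R

  -- Adding a multiple of row j+1 to row j, j ∉ T, keeps the pattern: if
  -- [j, b) meets T then so does [j+1, b).
  vanishes-step : ∀ {T M} j a b → j ∉ T → VanishesOn T M → VanishesOn T (E j a b · M)
  vanishes-step {T} {M} j a b j∉T M-vanishes {x} {y} meets = by-row (x Fin.≟ j) meets
    where
      by-row : Dec (x ≡ j) → Meets T x y → (E j a b · M) x y ≈R 0R
      by-row (no x≢j)     _                 = ≈R-trans (row-op-other _ M y x≢j) (M-vanishes meets)
      by-row (yes ≡.refl) (start _ x∈T)     = ⊥-elim (j∉T x∈T)
      by-row (yes ≡.refl) (later _ meets′)  k k<s = begin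
        (E x a b · M) x y k                     ≈⟨ row-op-pivot _ M y (j≢next-j x) k k<s ⟩
        M x y k + (lin a b *R M (next x) y) k   ≈⟨ +-cong (M-vanishes meets k k<s)
                                                          (*R-cong ≈R-refl (M-vanishes meets′) k k<s) ⟩
        0# + (lin a b *R 0R) k                  ≈⟨ +-identityˡ _ ⟩
        (lin a b *R 0R) k                       ≈⟨ *R-zeroʳ _ k k<s ⟩
        0#                                      ∎
        where open import Relation.Binary.Reasoning.Setoid setoid

  H-vanishes : ∀ {T M} → H T M → VanishesOn T M
  H-vanishes {T} = gen-induction (VanishesOn T)
    (λ M≈N M-vanishes meets → ≈R-trans (≈R-sym (M≈N _ _)) (M-vanishes meets))
    (λ meets k _ → reflexive (≡.cong (λ x → x k) (I-off (Meets-≢ meets))))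
    (λ j∉T _ → vanishes-step _ _ _ j∉T)

  K⊆H : ∀ {i M} → K i M → H [ i ] M
  K⊆H = ⟨⟩-mono λ { (j , j≢i , gen) → j , (λ { (here j≡i) → j≢i j≡i }) , gen }

  AgreeOff : Fin d → Mat → Mat → Set
  AgreeOff i M N = ∀ a b → Meets [ i ] a b ⊎ M a b ≈R N a b

  pivot-rows-agree : ∀ {M N} j a b y → M j y ≈R N j y → M (next j) y ≈R N (next j) y →
                     (E j a b · M) j y ≈R (E j a b · N) j y
  pivot-rows-agree {M} {N} j a b y row-j row-next =
    ≈R-trans (row-op-pivot _ M y (j≢next-j j))
      (≈R-trans (+R-cong row-j (*R-cong ≈R-refl row-next)) (≈R-sym (row-op-pivot _ N y (j≢next-j j))))

  module Intersection (i : Fin d) {T : List (Fin d)} {t : Fin d} (t∈T : t ∈ T) where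

    -- [j+1, j) is the whole circle minus j, so it meets T when j ∉ T.
    around-∉ : ∀ {U j} → t ∈ U → j ∉ T → Meets U (next j) j
    around-∉ {U} {j} t∈U j∉T = around U j t t∈U (λ { ≡.refl → j∉T t∈T })

    -- Multiplying M ∈ H T by E i a b changes M only at positions (i, y) that
    -- are ignored, except (i, i), which is unchanged as M (i+1, i) = 0.
    agree-pivot : ∀ {M N} a b → i ∉ T → H T M → AgreeOff i M N → AgreeOff i (E i a b · M) N
    agree-pivot {M} {N} a b i∉T M∈H agree x y = by-position (x Fin.≟ i) (y Fin.≟ i)
      where
        by-position : Dec (x ≡ i) → Dec (y ≡ i) → Meets [ i ] x y ⊎ (E i a b · M) x y ≈R N x y
        by-position (no x≢i) _ with agree x y
        ... | inj₁ meets = inj₁ meets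
        ... | inj₂ M≈N   = inj₂ (≈R-trans (row-op-other _ M y x≢i) M≈N)
        by-position (yes ≡.refl) (no y≢x) = inj₁ (start (λ x≡y → y≢x (≡.sym x≡y)) (here ≡.refl))
        by-position (yes ≡.refl) (yes ≡.refl) with agree x x
        ... | inj₁ meets = ⊥-elim (Meets-≢ meets ≡.refl)
        ... | inj₂ M≈N   = inj₂ λ k k<s → trans (row-op-pivot _ M x (j≢next-j x) k k<s)
          (trans (+-cong (M≈N k k<s) (*R-cong ≈R-refl (H-vanishes M∈H (around-∉ t∈T i∉T)) k k<s))
                 (trans (+-congˡ (*R-zeroʳ _ k k<s)) (+-identityʳ _)))

    -- For j ≠ i, apply the same generator to N.
    agree-other : ∀ {M N} j a b → j ∉ T → H T M → H (i ∷ T) N → AgreeOff i M N →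
                  AgreeOff i (E j a b · M) (E j a b · N)
    agree-other {M} {N} j a b j∉T M∈H N∈H agree x y = by-row (x Fin.≟ j)
      where
        by-row : Dec (x ≡ j) → Meets [ i ] x y ⊎ (E j a b · M) x y ≈R (E j a b · N) x y
        by-row (no x≢j) = Data.Sum.map₂ (λ M≈N → ≈R-trans (row-op-other _ M y x≢j)
                                           (≈R-trans M≈N (≈R-sym (row-op-other _ N y x≢j)))) (agree x y)
        by-row (yes ≡.refl) with agree x y | agree (next x) y
        ... | inj₁ meets | _             = inj₁ meets
        ... | inj₂ row-x | inj₂ row-next = inj₂ (pivot-rows-agree {M} {N} x a b y row-x row-next)
        ... | inj₂ row-x | inj₁ meets with x Fin.≟ y
        ...   | no x≢y     = inj₁ (later x≢y meets)
        ...   | yes ≡.refl = inj₂ (pivot-rows-agree {M} {N} x a b x row-x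
                  (≈R-trans (H-vanishes M∈H (around-∉ t∈T j∉T))
                            (≈R-sym (H-vanishes N∈H (around-∉ (there t∈T) j∉T)))))

    approximate : ∀ {M} → H T M → Σ Mat λ N → H (i ∷ T) N × AgreeOff i M N
    approximate = gen-induction (λ M → Σ Mat λ N → H (i ∷ T) N × AgreeOff i M N)
      (λ M≈M′ (N , N∈H , agree) → N , N∈H , λ x y → Data.Sum.map₂ (≈R-trans (≈R-sym (M≈M′ x y))) (agree x y))
      (I , g-id , λ x y → inj₂ ≈R-refl)
      extend
      where
        extend : ∀ {j a b M} → j ∉ T → H T M → (Σ Mat λ N → H (i ∷ T) N × AgreeOff i M N) →
               Σ Mat λ N → H (i ∷ T) N × AgreeOff i (E j a b · M) N
        extend {j} {a} {b} j∉T M∈H (N , N∈H , agree) with j Fin.≟ i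
        ... | yes ≡.refl = N , N∈H , agree-pivot a b j∉T M∈H agree
        ... | no j≢i = E j a b · N , g-gen (j , j∉i∷T , a , b , M-refl) N∈H ,
                       agree-other j a b j∉T M∈H N∈H agree
          where
            j∉i∷T : j ∉ i ∷ T
            j∉i∷T (here j≡i)  = j≢i j≡i
            j∉i∷T (there j∈T) = j∉T j∈T

    -- K i ∩ H T ⊆ H (i ∷ T): elements of K i and of H (i ∷ T) both vanish
    -- at the i-positions, where the approximation may differ.
    intersection : ∀ {M} → K i M → H T M → H (i ∷ T) M
    intersection {M} M∈K M∈H with approximate M∈H
    ... | N , N∈H , agree = g-resp N≈M N∈H
      where
        N≈M : N ≈M M
        N≈M x y with agree x y
        ... | inj₂ M≈N  = ≈R-sym M≈N
        ... | inj₁ meets = ≈R-trans (H-vanishes N∈H (Meets-mono (λ { (here x≡i) → here x≡i }) meets))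
                                    (≈R-sym (H-vanishes (K⊆H M∈K) meets))

  open Intersection using (intersection)

  ⋂K⊆H : ∀ {M} t T → (∀ {i} → i ∈ t ∷ T → K i M) → H (t ∷ T) M
  ⋂K⊆H t []       M∈K = K⊆H (M∈K (here ≡.refl))
  ⋂K⊆H t (u ∷ T)  M∈K = intersection t (here ≡.refl) (M∈K (here ≡.refl)) (⋂K⊆H u T (λ i∈ → M∈K (there i∈)))

module LinkConnectivity (𝔽 : FiniteField) (s n : ℕ) where
  open import Data.Nat using (ℕ; suc; _≤_; s≤s)
  open import Data.Nat.Properties using (m≤n⇒m≤1+n)
  open import Function using (_∘_)
  open import Data.Fin as Fin using (Fin)
  open import Data.List using (List; []; _∷_; map; length)
  open import Data.List.Properties using (length-map)
  open import Data.List.Relation.Unary.All as All using (All; []; _∷_)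
  open import Data.List.Relation.Unary.All.Properties using (¬Any⇒All¬)
  import Data.List.Relation.Unary.All.Properties as Allₚ
  open import Data.List.Relation.Unary.AllPairs using (AllPairs; []; _∷_)
  open import Data.List.Relation.Unary.Any using (here; there)
  import Data.List.Relation.Unary.Any.Properties as Any
  open import Data.List.Membership.Propositional using (_∉_)
  open import Data.Product using (Σ; _×_; _,_)
  open import Relation.Nullary using (yes; no)
  import Relation.Binary.PropositionalEquality as ≡
  open ≡ using (_≡_; _≢_)

  open ElementarySubgroups 𝔽 s n using (d; Gen; generator-invertible; ⋂K⊆H)
  open Construction 𝔽 s d
  open Matrices 𝔽 s d
  open GeneratedSubgroups 𝔽 s d
  open CyclicOrder (suc n) using (missing)
  open import Relation.Binary.Reasoning.Setoid MatSetoid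

  K⊆G : ∀ {i M} → K i M → G M
  K⊆G {i} M∈K = generator-∈ (i , M∈K)

  K-invertible : ∀ {i g} → K i g → Invertible {GenK i} g
  K-invertible = invertible generator-invertible

  K-left-inverse : ∀ {i g h} → K i g → (h · g) ≈M I → K i h
  K-left-inverse = left-inverse-∈ generator-invertible

  G-invertible : ∀ {g} → G g → Invertible {λ M → Σ (Fin d) λ i → K i M} g
  G-invertible = invertible λ { (i , g∈K) → let (g′ , g′∈K , gg′ , g′g) = K-invertible g∈K
                                              in g′ , K⊆G g′∈K , gg′ , g′g }

  inc-self : ∀ u → InCoset (rep u) u
  inc-self u = I , g-id , M-sym (I-identityʳ _)

  inc-resp : ∀ {x x′} u → x ≈M x′ → InCoset x u → InCoset x′ u
  inc-resp u x≈x′ (k , k∈K , x≈rk) = k , k∈K , M-trans (M-sym x≈x′) x≈rk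

  inc-mul : ∀ {x g} u → InCoset x u → K (type u) g → InCoset (x · g) u
  inc-mul {x} {g} u (k , k∈K , x≈rk) g∈K =
    k · g , ·-closed k∈K g∈K , M-trans (·-congʳ g x≈rk) (·-assoc _ _ _)

  coset-⊆ : ∀ {u w x} → type u ≡ type w → InCoset (rep w) u → InCoset x w → InCoset x u
  coset-⊆ {u} ≡.refl w∈u (k , k∈K , x≈wk) = inc-resp u (M-sym x≈wk) (inc-mul u w∈u k∈K)

  rep-∈ : ∀ {x} u → InCoset x u → Σ Mat λ k′ → K (type u) k′ × (rep u ≈M (x · k′))
  rep-∈ {x} u (k , k∈K , x≈uk) with K-invertible k∈K
  ... | k′ , k′∈K , kk′ , _ = k′ , k′∈K , (begin
    rep u              ≈⟨ I-identityʳ _ ⟨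
    rep u · I          ≈⟨ ·-congˡ (rep u) kk′ ⟨
    rep u · (k · k′)   ≈⟨ ·-assoc _ _ _ ⟨
    (rep u · k) · k′   ≈⟨ ·-congʳ k′ x≈uk ⟨
    x · k′             ∎)

  coset-quotient : ∀ {x y x⁻¹} u → (x⁻¹ · x) ≈M I → InCoset x u → InCoset y u → K (type u) (x⁻¹ · y)
  coset-quotient {x} {y} {x⁻¹} u x⁻¹x≈I x∈u (l , l∈K , y≈ul) = via-rep (rep-∈ u x∈u)
    where
      r : Mat
      r = rep u
      via-rep : Σ Mat (λ k′ → K (type u) k′ × (r ≈M (x · k′))) → K (type u) (x⁻¹ · y)
      via-rep (k′ , k′∈K , r≈xk′) = g-resp (M-sym x⁻¹y≈k′l) (·-closed k′∈K l∈K)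
        where
          x⁻¹y≈k′l : (x⁻¹ · y) ≈M (k′ · l)
          x⁻¹y≈k′l = begin
            x⁻¹ · y                ≈⟨ ·-congˡ x⁻¹ y≈ul ⟩
            x⁻¹ · (r · l)          ≈⟨ ·-congˡ x⁻¹ (·-congʳ l r≈xk′) ⟩
            x⁻¹ · ((x · k′) · l)   ≈⟨ ·-congˡ x⁻¹ (·-assoc x k′ l) ⟩
            x⁻¹ · (x · (k′ · l))   ≈⟨ ·-assoc x⁻¹ x (k′ · l) ⟨
            (x⁻¹ · x) · (k′ · l)   ≈⟨ ·-congʳ (k′ · l) x⁻¹x≈I ⟩
            I · (k′ · l)           ≈⟨ I-identityˡ (k′ · l) ⟩
            k′ · l                 ∎

  same-vertex-refl : ∀ u → SameVertex u u
  same-vertex-refl u = ≡.refl , inc-self u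

  same-vertex-trans : ∀ {u w z} → SameVertex u w → SameVertex w z → SameVertex u z
  same-vertex-trans {u} {w} (tu≡tw , w∈u) (tw≡tz , z∈w) = ≡.trans tu≡tw tw≡tz , coset-⊆ {u} {w} tu≡tw w∈u z∈w

  face-resp-head : ∀ {u w vs} → SameVertex u w → IsFace (w ∷ vs) → IsFace (u ∷ vs)
  face-resp-head {u} {w} (tu≡tw , w∈u) ((w-distinct ∷ distinct) , x , x∈G , (x∈w ∷ x∈vs)) =
    (All.map (λ tw≢t tu≡t → tw≢t (≡.trans (≡.sym tu≡tw) tu≡t)) w-distinct ∷ distinct) ,
    x , x∈G , (coset-⊆ {u} {w} tu≡tw w∈u x∈w ∷ x∈vs)

  reach-trans : ∀ {v u w z} → Reach v u w → Reach v w z → Reach v u z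
  reach-trans (step face u⇝w) w⇝z = step face (reach-trans u⇝w w⇝z)
  reach-trans {u = u} {w} {z} (here u~w) (here w~z) = here (same-vertex-trans {u} {w} {z} u~w w~z)
  reach-trans (here u~w) (step face w⇝z) = step (face-resp-head u~w face) w⇝z

  vertex : Fin d → (z : Mat) → G z → Vertex
  vertex k z z∈G = record { type = k ; rep = z ; repInG = z∈G }

  on-all-mul : ∀ {z g vs} → All (InCoset z) vs → All (λ w → K (type w) g) vs → All (InCoset (z · g)) vs
  on-all-mul []                        []               = []
  on-all-mul {vs = u ∷ _} (z∈u ∷ z∈vs) (g∈K ∷ g∈Ks) = inc-mul u z∈u g∈K ∷ on-all-mul z∈vs g∈Ks

  stabilises : ∀ {y z y⁻¹ vs} → (y⁻¹ · y) ≈M I → All (InCoset y) vs → All (InCoset z) vs →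
               All (λ w → K (type w) (y⁻¹ · z)) vs
  stabilises y⁻¹y []                        []               = []
  stabilises {vs = u ∷ _} y⁻¹y (y∈u ∷ y∈vs) (z∈u ∷ z∈vs) = coset-quotient u y⁻¹y y∈u z∈u ∷ stabilises y⁻¹y y∈vs z∈vs

  types-length : ∀ vs → length vs ≤ n → length (map type vs) ≤ n
  types-length vs = ≡.subst (_≤ n) (≡.sym (length-map type vs))

  module Link (v : List Vertex) (distinct : AllPairs (λ u w → type u ≢ type w) v) where

    Free : Fin d → Set
    Free k = All (λ w → k ≢ type w) v

    free : ∀ {k} → k ∉ map type v → Free k
    free k∉ = ¬Any⇒All¬ v (k∉ ∘ Any.map⁺)

    edge : ∀ {u w z} → type u ≢ type w → Free (type u) → Free (type w) → G z →
           InCoset z u → InCoset z w → All (InCoset z) v → Reach v u w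
    edge {u} {w} {z} tu≢tw u-free w-free z∈G z∈u z∈w z∈v =
      step {u = u} {w = w} (((tu≢tw ∷ u-free) ∷ (w-free ∷ distinct)) , z , z∈G , (z∈u ∷ z∈w ∷ z∈v)) (here (same-vertex-refl w))

    star : ∀ {z} (z∈G : G z) → All (InCoset z) v → ∀ {k k′} → Free k → Free k′ →
           Reach v (vertex k z z∈G) (vertex k′ z z∈G)
    star {z} z∈G z∈v {k} {k′} k-free k′-free with k Fin.≟ k′
    ... | yes ≡.refl = here (same-vertex-refl (vertex k z z∈G))
    ... | no k≢k′    = edge k≢k′ k-free k′-free z∈G (inc-self (vertex k z z∈G)) (inc-self (vertex k′ z z∈G)) z∈v

    Admissible : Mat → Set
    Admissible g = Σ (Fin d) λ c → Free c × K c g × All (λ w → K (type w) g) v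

    admissible-left-inverse : ∀ {g h} → Admissible g → (h · g) ≈M I → Admissible h
    admissible-left-inverse (c , c-free , g∈K , g-stab) hg≈I =
      c , c-free , K-left-inverse g∈K hg≈I , All.map (λ g∈K′ → K-left-inverse g∈K′ hg≈I) g-stab

    -- Right multiplication by an admissible g moves along the link: the
    -- vertices z K_c and z g K_c coincide.
    move : ∀ {z g k k′} (z∈G : G z) (zg∈G : G (z · g)) → All (InCoset z) v → Admissible g →
           Free k → Free k′ → Reach v (vertex k z z∈G) (vertex k′ (z · g) zg∈G)
    move {g = g} z∈G zg∈G z∈v (c , c-free , g∈K , g-stab) k-free k′-free =
      reach-trans (star z∈G z∈v k-free c-free)
        (reach-trans (here (≡.refl , (g , g∈K , M-refl)))
          (star zg∈G (on-all-mul z∈v g-stab) c-free k′-free))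

    Walkable : Mat → Set
    Walkable M = ∀ {z z′ k k′} (z∈G : G z) (z′∈G : G z′) → All (InCoset z) v → z′ ≈M (z · M) →
                 Free k → Free k′ → Reach v (vertex k z z∈G) (vertex k′ z′ z′∈G)

    walk-step : ∀ {g M} → Admissible g → Walkable M → Walkable (g · M)
    walk-step {g} {M} g-adm@(_ , _ , g∈K , g-stab) walk-M {z} z∈G z′∈G z∈v z′≈ k-free k′-free =
      reach-trans (move z∈G zg∈G z∈v g-adm k-free k-free)
        (walk-M zg∈G z′∈G (on-all-mul z∈v g-stab) (M-trans z′≈ (M-sym (·-assoc z g M))) k-free k′-free)
      where
        zg∈G : G (z · g)
        zg∈G = ·-closed z∈G (K⊆G g∈K)

    walk : ∀ {M} → ⟨ Admissible ⟩ M → Walkable M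
    walk g-id z∈G z′∈G z∈v z′≈ k-free k′-free =
      reach-trans (star z∈G z∈v k-free k′-free) (here (≡.refl , (I , g-id , z′≈)))
    walk (g-gen g-adm M∈)      = walk-step g-adm (walk M∈)
    walk (g-inv g-adm hg≈I M∈) = walk-step (admissible-left-inverse g-adm hg≈I) (walk M∈)
    walk (g-resp M≈N M∈) {z} z∈G z′∈G z∈v z′≈ =
      walk M∈ z∈G z′∈G z∈v (M-trans z′≈ (·-congˡ z (M-sym M≈N)))

    -- If some point lies in all cosets of v, some type is free, and the
    -- stabiliser of v in G is generated by admissible elements, then the
    -- link of v is connected: two link vertices through points y and z are
    -- joined by walking along y⁻¹ z.
    connected : ∀ {x} → G x → All (InCoset x) v → Σ (Fin d) Free →
                (∀ {M} → G M → All (λ w → K (type w) M) v → ⟨ Admissible ⟩ M) →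
                LinkConnected v
    connected {x} x∈G x∈v (k , k-free) generated =
      (vertex k x x∈G , (k-free ∷ distinct) , x , x∈G , (inc-self (vertex k x x∈G) ∷ x∈v)) , joined
      where
        joined : ∀ u w → IsFace (u ∷ v) → IsFace (w ∷ v) → Reach v u w
        joined u w ((u-free ∷ _) , y , y∈G , (y∈u ∷ y∈v)) ((w-free ∷ _) , z , z∈G , (z∈w ∷ z∈v))
          with G-invertible y∈G
        ... | y⁻¹ , y⁻¹∈G , yy⁻¹ , y⁻¹y =
          reach-trans (here (≡.refl , y∈u))
            (reach-trans (walk quotient∈ y∈G z∈G y∈v z≈ u-free w-free)
              (here (≡.refl , rep-∈ w z∈w)))
          where
            quotient∈ : ⟨ Admissible ⟩ (y⁻¹ · z)
            quotient∈ = generated (·-closed y⁻¹∈G z∈G) (stabilises y⁻¹y y∈v z∈v)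
            z≈ : z ≈M (y · (y⁻¹ · z))
            z≈ = begin
              z               ≈⟨ I-identityˡ z ⟨
              I · z           ≈⟨ ·-congʳ z yy⁻¹ ⟨
              (y · y⁻¹) · z   ≈⟨ ·-assoc y y⁻¹ z ⟩
              y · (y⁻¹ · z)   ∎

    -- For |v| ≤ d - 2 every generator E j a b with j ∉ types v is
    -- admissible: besides j some other type c is free, and E j a b ∈ K c.
    generator-admissible : length v ≤ n → ∀ {g} → Gen (_∉ map type v) g → Admissible g
    generator-admissible len (j , j∉T , a , b , g≈E)
      with missing (j ∷ map type v) (s≤s (s≤s (types-length v len)))
    ... | c , c∉ =
      c , free (c∉ ∘ there) , generator-∈ (j , (λ j≡c → c∉ (here (≡.sym j≡c))) , a , b , g≈E) ,
      All.map (λ j≢t → generator-∈ (j , j≢t , a , b , g≈E)) (free j∉T)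

  -- The stabiliser G ∩ ⋂_{w ∈ v} K (type w) of a face v with |v| ≤ d - 2 is
  -- generated by admissible elements: for v = [] it is G = ⟨ ⋃ K i ⟩, and
  -- otherwise it lies in H (types of v) = ⟨ E j a b : j ∉ types v ⟩ by the
  -- intersection theorem.
  stabiliser-generated : ∀ v distinct → length v ≤ n → ∀ {M} → G M → All (λ w → K (type w) M) v →
                         ⟨ Link.Admissible v distinct ⟩ M
  stabiliser-generated [] [] _ M∈G _ = ⟨⟩-mono (λ { (i , g∈K) → i , [] , g∈K , [] }) M∈G
  stabiliser-generated (w ∷ ws) distinct len _ M-stab =
    ⟨⟩-mono (Link.generator-admissible (w ∷ ws) distinct len)
            (⋂K⊆H (type w) (map type ws) (All.lookup (Allₚ.map⁺ M-stab)))

  link-connected : (v : List Vertex) → IsFace v → length v ≤ n → LinkConnected v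
  link-connected v (distinct , x , x∈G , x∈v) len with missing (map type v) (s≤s (m≤n⇒m≤1+n (types-length v len)))
  ... | k , k∉ = connected x∈G x∈v (k , free k∉) (stabiliser-generated v distinct len)
    where open Link v distinct

-- The main theorem is link-connected for d = n + 2.
mainTheorem6 : (𝔽 : FiniteField) (s d : ℕ) → 1 ≤ s → 2 ≤ d →
    let open Construction 𝔽 s d in
    (v : List Vertex) → IsFace v → length v ≤ d ∸ 2 → LinkConnected v
mainTheorem6 𝔽 s (suc (suc n)) _ (s≤s (s≤s z≤n)) = LinkConnectivity.link-connected 𝔽 s n
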